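{- For every natural number $k\ge 1$ there exists a parity signed graph $S$ whose underlying graph $G$ satisfies $\sigma^-(G)=k$.
   Context: For a graph $G$ with $N$ vertices and a bijection $f:V(G)\to\{1,\dots,N\}$, define $\sigma_f(uv)=+$ if $f(u),f(v)$ have the same parity and $\sigma_f(uv)=-$ otherwise; a signed graph $(G,\sigma)$ is a parity signed graph if $\sigma=\sigma_f$ for some such $f$. The rna number $\sigma^-(G)$ (also written $\sigma^-(S)$ for a signed graph $S$ on $G$) is the minimum over all such bijections $f$ of the number of edges $uv$ with $\sigma_f(uv)=-$. -}

module Defs where

open import Data.Nat using (ℕ; suc; _+_; _≤_; _<_)
open import Data.Nat.Properties using (_<?_)
open import Data.Bool using (Bool; true; false; if_then_else_)
open import Data.Fin using (Fin; toℕ)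
open import Data.List using (List; map; allFin)
open import Data.Nat.ListAction using (sum)
open import Data.Nat.Base using (_%_)
open import Data.Product using (Σ; ∃; _×_; _,_)
open import Relation.Binary.PropositionalEquality using (_≡_)
open import Relation.Nullary using (¬_)
open import Relation.Nullary.Decidable using (⌊_⌋)
open import Function.Definitions using (Bijective)

record Graph (n : ℕ) : Set where
  field
    adj    : Fin n → Fin n → Bool
    sym    : ∀ u v → adj u v ≡ adj v u
    irrefl : ∀ u → adj u u ≡ false
open Graph public

-- A labelling: a bijection f : V(G) → {1,…,N}; we encode {1,…,N} as Fin N
-- with value i ∈ Fin N standing for the label toℕ i + 1.
Labelling : ℕ → Set
Labelling n = Σ (Fin n → Fin n) (Bijective _≡_ _≡_)

label : ∀ {n} → (Fin n → Fin n) → Fin n → ℕ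
label f u = suc (toℕ (f u))

data Sign : Set where
  plus minus : Sign

σ[_] : ∀ {n} → (Fin n → Fin n) → Fin n → Fin n → Sign
σ[ f ] u v with label f u % 2 Data.Nat.Base.≡ᵇ label f v % 2
... | true  = plus
... | false = minus

isMinus : Sign → Bool
isMinus plus  = false
isMinus minus = true

-- A signed graph on G is a sign for each edge (given as a function on
-- vertex pairs; only values on edges matter).
Signature : ℕ → Set
Signature n = Fin n → Fin n → Sign

IsParitySigned : ∀ {n} → Graph n → Signature n → Set
IsParitySigned {n} G σ =
  ∃ λ (f : Labelling n) →
    ∀ u v → adj G u v ≡ true → σ u v ≡ σ[ Data.Product.proj₁ f ] u v

negEdges : ∀ {n} → Graph n → (Fin n → Fin n) → ℕ
negEdges {n} G f =
  sum (map (λ u → sum (map (λ v →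
    if ⌊ toℕ u <? toℕ v ⌋ then
      (if adj G u v then (if isMinus (σ[ f ] u v) then 1 else 0) else 0)
    else 0) (allFin n))) (allFin n))

RnaNumberIs : ∀ {n} → Graph n → ℕ → Set
RnaNumberIs {n} G k =
  (∃ λ (f : Labelling n) → negEdges G (Data.Product.proj₁ f) ≡ k)
  × (∀ (f : Labelling n) → k ≤ negEdges G (Data.Product.proj₁ f))

-- On the star K₁,₂ₖ every edge contains the centre, so an edge is negative exactly when
-- its leaf label has the parity opposite to the centre label. The labels 1, …, 2k+1
-- comprise k+1 odd and k even numbers, hence a labelling has k negative edges if the
-- centre label is odd and k+1 if it is even.
module Submission where

open import Defs
open import Data.Nat using (ℕ; zero; suc; _+_; _*_; _%_; _≡ᵇ_; _≤_)
open import Data.Nat.Properties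
  using (+-0-monoid; +-0-commutativeMonoid; +-comm; +-assoc; +-identityʳ; m≤n+m; _<?_)
open import Data.Fin using (Fin; toℕ) renaming (zero to fzero; suc to fsuc)
open import Data.Bool using (Bool; true; false; if_then_else_)
open import Data.List using (map; allFin; tabulate)
open import Data.List.Properties using (map-tabulate)
import Data.Nat.ListAction as List
open import Data.Product using (Σ; ∃; _×_; _,_)
open import Function using (id; _∘_)
open import Function.Bundles using (mk⤖)
open import Function.Definitions using (Bijective)
open import Function.Properties.Bijection using (⤖⇒↔)
open import Relation.Binary.PropositionalEquality using (_≡_; refl; trans; cong; subst; module ≡-Reasoning)
  renaming (sym to ≡-sym)
open import Relation.Nullary.Decidable using (⌊_⌋)
open import Algebra.Properties.Monoid.Sum +-0-monoid using (sum; sum-cong-≗; sum-replicate-zero)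
open import Algebra.Properties.CommutativeMonoid.Sum +-0-commutativeMonoid using (sum-permute)

sum-tabulate : ∀ {n} (h : Fin n → ℕ) → List.sum (tabulate h) ≡ sum h
sum-tabulate {zero}  h = refl
sum-tabulate {suc n} h = cong (h fzero +_) (sum-tabulate (h ∘ fsuc))

sum-map-allFin : ∀ {n} (h : Fin n → ℕ) → List.sum (map h (allFin n)) ≡ sum h
sum-map-allFin h = trans (cong List.sum (map-tabulate id h)) (sum-tabulate h)

sum-∘-bijective : ∀ {n} (g : Fin n → ℕ) {f : Fin n → Fin n} →
                  Bijective _≡_ _≡_ f → sum (g ∘ f) ≡ sum g
sum-∘-bijective g bij = ≡-sym (sum-permute g (⤖⇒↔ (mk⤖ bij)))

parityDiff : ℕ → ℕ → ℕ
parityDiff a b = if a % 2 ≡ᵇ b % 2 then 0 else 1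

parityDiff-refl : ∀ a → parityDiff a a ≡ 0
parityDiff-refl zero          = refl
parityDiff-refl (suc zero)    = refl
parityDiff-refl (suc (suc a)) = parityDiff-refl a

parityDiff-zero-one : ∀ a → parityDiff a 0 + parityDiff a 1 ≡ 1
parityDiff-zero-one zero          = refl
parityDiff-zero-one (suc zero)    = refl
parityDiff-zero-one (suc (suc a)) = parityDiff-zero-one a

parityDiff-consecutive : ∀ a m → parityDiff a m + parityDiff a (suc m) ≡ 1
parityDiff-consecutive a zero          = parityDiff-zero-one a
parityDiff-consecutive a (suc zero)    = trans (+-comm (parityDiff a 1) _) (parityDiff-zero-one a)
parityDiff-consecutive a (suc (suc m)) = parityDiff-consecutive a m

sum-parityDiff-interval : ∀ a m k → sum (λ (y : Fin (k * 2)) → parityDiff a (toℕ y + m)) ≡ k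
sum-parityDiff-interval a m zero    = refl
sum-parityDiff-interval a m (suc k) = begin
  parityDiff a m + (parityDiff a (suc m) + sum (λ (y : Fin (k * 2)) → parityDiff a (toℕ y + m)))
    ≡⟨ cong (λ s → parityDiff a m + (parityDiff a (suc m) + s)) (sum-parityDiff-interval a m k) ⟩
  parityDiff a m + (parityDiff a (suc m) + k)
    ≡⟨ ≡-sym (+-assoc (parityDiff a m) _ k) ⟩
  (parityDiff a m + parityDiff a (suc m)) + k
    ≡⟨ cong (_+ k) (parityDiff-consecutive a m) ⟩
  suc k ∎
  where open ≡-Reasoning

sum-parityDiff-labels : ∀ a k →
  sum (λ (y : Fin (suc (k * 2))) → parityDiff a (suc (toℕ y))) ≡ parityDiff a 1 + k
sum-parityDiff-labels a k = cong (parityDiff a 1 +_) (begin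
  sum (λ (y : Fin (k * 2)) → parityDiff a (2 + toℕ y))
    ≡⟨ sum-cong-≗ shift ⟩
  sum (λ (y : Fin (k * 2)) → parityDiff a (toℕ y + 2))
    ≡⟨ sum-parityDiff-interval a 2 k ⟩
  k ∎)
  where
  open ≡-Reasoning
  shift : ∀ (y : Fin (k * 2)) → parityDiff a (2 + toℕ y) ≡ parityDiff a (toℕ y + 2)
  shift y = cong (parityDiff a) (+-comm 2 (toℕ y))

minusIndicator : Sign → ℕ
minusIndicator s = if isMinus s then 1 else 0

minusIndicator-σ : ∀ {n} (f : Fin n → Fin n) u v →
  minusIndicator (σ[ f ] u v) ≡ parityDiff (label f u) (label f v)
minusIndicator-σ f u v with label f u % 2 ≡ᵇ label f v % 2
... | true  = refl
... | false = refl

starAdj : ∀ {n} → Fin n → Fin n → Bool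
starAdj fzero    fzero    = false
starAdj fzero    (fsuc _) = true
starAdj (fsuc _) fzero    = true
starAdj (fsuc _) (fsuc _) = false

star : ∀ n → Graph n
star n = record { adj = starAdj ; sym = starAdj-sym ; irrefl = starAdj-irrefl }
  where
  starAdj-sym : ∀ u v → starAdj u v ≡ starAdj v u
  starAdj-sym fzero    fzero    = refl
  starAdj-sym fzero    (fsuc _) = refl
  starAdj-sym (fsuc _) fzero    = refl
  starAdj-sym (fsuc _) (fsuc _) = refl
  starAdj-irrefl : ∀ u → starAdj u u ≡ false
  starAdj-irrefl fzero    = refl
  starAdj-irrefl (fsuc _) = refl

negEdges-star : ∀ n (f : Fin (suc n) → Fin (suc n)) →
  negEdges (star (suc n)) f ≡ sum (λ v → parityDiff (label f fzero) (label f v))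
negEdges-star n f = begin
  negEdges (star (suc n)) f
    ≡⟨ sum-map-allFin (λ u → List.sum (map (edgeTerm u) (allFin (suc n)))) ⟩
  sum (λ (u : Fin (suc n)) → List.sum (map (edgeTerm u) (allFin (suc n))))
    ≡⟨ sum-cong-≗ (λ u → sum-map-allFin (edgeTerm u)) ⟩
  sum (edgeTerm fzero) + sum (λ (u : Fin n) → sum (edgeTerm (fsuc u)))
    ≡⟨ cong (sum (edgeTerm fzero) +_) leafRows-vanish ⟩
  sum (edgeTerm fzero) + 0
    ≡⟨ +-identityʳ _ ⟩
  sum (edgeTerm fzero)
    ≡⟨ sum-cong-≗ centreRow ⟩
  sum (λ v → parityDiff (label f fzero) (label f v)) ∎
  where
  open ≡-Reasoning
  edgeTerm : Fin (suc n) → Fin (suc n) → ℕ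
  edgeTerm u v = if ⌊ toℕ u <? toℕ v ⌋
    then (if starAdj u v then minusIndicator (σ[ f ] u v) else 0)
    else 0
  leafRow-vanish : ∀ u v → edgeTerm (fsuc u) v ≡ 0
  leafRow-vanish u fzero    = refl
  leafRow-vanish u (fsuc v) with ⌊ toℕ (fsuc u) <? toℕ (fsuc v) ⌋
  ... | true  = refl
  ... | false = refl
  leafRows-vanish : sum (λ (u : Fin n) → sum (edgeTerm (fsuc u))) ≡ 0
  leafRows-vanish = trans
    (sum-cong-≗ (λ u → trans (sum-cong-≗ (leafRow-vanish u)) (sum-replicate-zero (suc n))))
    (sum-replicate-zero n)
  centreRow : ∀ v → edgeTerm fzero v ≡ parityDiff (label f fzero) (label f v)
  centreRow fzero    = ≡-sym (parityDiff-refl (label f fzero))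
  centreRow (fsuc w) = minusIndicator-σ f fzero (fsuc w)

negEdges-star-labelling : ∀ k ((f , _) : Labelling (suc (k * 2))) →
  negEdges (star (suc (k * 2))) f ≡ parityDiff (label f fzero) 1 + k
negEdges-star-labelling k (f , bij) = begin
  negEdges (star (suc (k * 2))) f
    ≡⟨ negEdges-star (k * 2) f ⟩
  sum (λ v → parityDiff (label f fzero) (label f v))
    ≡⟨ sum-∘-bijective (λ y → parityDiff (label f fzero) (suc (toℕ y))) bij ⟩
  sum (λ (y : Fin (suc (k * 2))) → parityDiff (label f fzero) (suc (toℕ y)))
    ≡⟨ sum-parityDiff-labels (label f fzero) k ⟩
  parityDiff (label f fzero) 1 + k ∎
  where open ≡-Reasoning

identityLabelling : ∀ {n} → Labelling n
identityLabelling = id , (id , λ y → y , id)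

theorem13 : (k : ℕ) → 1 ≤ k →
    ∃ λ (n : ℕ) → Σ (Graph n) λ G → Σ (Signature n) λ σ →
      IsParitySigned G σ × RnaNumberIs G k
theorem13 k _ =
  suc (k * 2) , star (suc (k * 2)) , σ[ id ] ,
  (identityLabelling , λ _ _ _ → refl) ,
  (identityLabelling , negEdges-star-labelling k identityLabelling) ,
  λ f → subst (k ≤_) (≡-sym (negEdges-star-labelling k f)) (m≤n+m k _)
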